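{- For any positive integer $n$, the number of inequivalent integer quadrilaterals with perimeter $n$ is the nearest integer to $\frac{n^3-3n^2+20n}{96}$ if $n$ is even, and the nearest integer to $\frac{n^3-7n}{96}$ if $n$ is odd.
   Context: An integer quadrilateral is a $4$-sided polygon whose side lengths are all positive integers; its perimeter is the sum of the side lengths. Reading the side lengths starting from any side, clockwise or anticlockwise, gives a $4$-tuple; two quadrilaterals are equivalent if the $4$-tuple of one can be obtained from that of the other by cyclically re-ordering and/or reversing the entries. (Side-length tuples of integer quadrilaterals of perimeter $n$ are exactly $4$-tuples of positive integers summing to $n$ with every entry less than $n/2$.) -}

module Defs where

open import Data.Nat using (ℕ; zero; suc; _+_; _*_; _<_; _≤_)
open import Data.Integer as ℤ using (ℤ; +_; ∣_∣)
open import Data.Fin using (Fin)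
open import Data.Product using (Σ; ∃; _×_; _,_)
open import Data.Sum using (_⊎_)
open import Relation.Binary.PropositionalEquality using (_≡_)

-- 4-tuples of natural numbers (side lengths read around the quadrilateral)
Tuple4 : Set
Tuple4 = ℕ × ℕ × ℕ × ℕ

-- side-length tuples of integer quadrilaterals of perimeter n:
-- positive entries summing to n, every entry less than n/2 (i.e. 2x < n)
IsQuadTuple : ℕ → Tuple4 → Set
IsQuadTuple n (a , b , c , d) =
  (1 ≤ a × 1 ≤ b × 1 ≤ c × 1 ≤ d) ×
  (a + b + c + d ≡ n) ×
  (2 * a < n × 2 * b < n × 2 * c < n × 2 * d < n)

Quad : ℕ → Set
Quad n = Σ Tuple4 (IsQuadTuple n)

rot : Tuple4 → Tuple4
rot (a , b , c , d) = (b , c , d , a)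

rev : Tuple4 → Tuple4
rev (a , b , c , d) = (d , c , b , a)

Equiv : Tuple4 → Tuple4 → Set
Equiv t t' =
  (t' ≡ t) ⊎ (t' ≡ rot t) ⊎ (t' ≡ rot (rot t)) ⊎ (t' ≡ rot (rot (rot t))) ⊎
  (t' ≡ rev t) ⊎ (t' ≡ rot (rev t)) ⊎ (t' ≡ rot (rot (rev t))) ⊎ (t' ≡ rot (rot (rot (rev t))))

EquivQ : {n : ℕ} → Quad n → Quad n → Set
EquivQ (t , _) (t' , _) = Equiv t t'

NumClasses : ℕ → ℕ → Set
NumClasses n k =
  Σ (Fin k → Quad n) λ r →
    (∀ i j → EquivQ (r i) (r j) → i ≡ j) ×
    (∀ (q : Quad n) → ∃ λ i → EquivQ q (r i))

-- k is the nearest integer to N / 96  (|96k - N| < 48, i.e. 2|96k - N| < 96)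
IsNearestTo/96 : ℕ → ℤ → Set
IsNearestTo/96 k N = 2 * ∣ (+ 96) ℤ.* (+ k) ℤ.- N ∣ < 96

module Submission where

-- Let h be the longest admissible side (n = 2h + 1 or 2h + 2).
-- The side tuples of perimeter n split into three invariant, pairwise apart
-- parts: (1) all sides in [2, h), which after shortening every side by one are
-- exactly the tuples of perimeter n − 4; (2) all sides below h and some side 1,
-- whose canonical representatives (shortest side first), complemented to h,
-- are the triples (d, e, c) with d, c ≥ 1 and 2d + e + c = 3h + 1 − n; (3) some
-- side h, whose canonical representatives (longest side first) are the
-- triples for n − h.  With t(s) the number of such triples, t(s + 2) = s + t(s),
-- so the count k obeys k(n) = k(n − 4) + t(j) + t(j + 3) for n = 2j + 4 and
-- k(n) = k(n − 4) + t(j + 2) + t(j + 3) for n = 2j + 5.  Then 96 times the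
-- increment equals the increment of n³ − 3n² + 20n (even n), resp. n³ − 7n
-- (odd n), so the error 96k − P(n) depends only on n mod 4 and is 0, 6, −36
-- or −6.  Order of the file: equivalence and invariance, transversals (class
-- representatives), canonical forms, triples, the three parts, the closed form.

open import Defs
open import Data.Nat using (ℕ; zero; suc; _+_; _*_; _∸_; _≤_; _<_; _%_; z≤n; s≤s; _<?_; _≟_)
open import Data.Nat.Properties
open import Data.Nat.DivMod using (m*n%n≡0; [m+kn]%n≡m%n)
open import Data.Nat.Tactic.RingSolver using (solve-∀)
open import Data.Integer as ℤ using (ℤ; +_; ∣_∣)
import Data.Integer.Properties as ℤ
import Data.Integer.Tactic.RingSolver as ℤ-Ring
open import Data.Fin using (Fin; zero; splitAt; _↑ˡ_; _↑ʳ_)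
open import Data.Fin.Properties using (splitAt-↑ˡ; splitAt-↑ʳ; splitAt⁻¹-↑ˡ; splitAt⁻¹-↑ʳ)
open import Data.Product using (∃; _×_; _,_; proj₁; proj₂)
open import Data.Sum using (_⊎_; inj₁; inj₂; [_,_]′)
open import Data.Empty using (⊥; ⊥-elim)
open import Relation.Nullary using (¬_; Dec; yes; no; contradiction)
open import Relation.Nullary.Decidable using (toWitness)
open import Relation.Binary.PropositionalEquality
  using (_≡_; refl; sym; trans; cong; cong₂; subst; module ≡-Reasoning)

pattern same p  = inj₁ p
pattern rot¹ p  = inj₂ (inj₁ p)
pattern rot² p  = inj₂ (inj₂ (inj₁ p))
pattern rot³ p  = inj₂ (inj₂ (inj₂ (inj₁ p)))
pattern flip⁰ p = inj₂ (inj₂ (inj₂ (inj₂ (inj₁ p))))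
pattern flip¹ p = inj₂ (inj₂ (inj₂ (inj₂ (inj₂ (inj₁ p)))))
pattern flip² p = inj₂ (inj₂ (inj₂ (inj₂ (inj₂ (inj₂ (inj₁ p))))))
pattern flip³ p = inj₂ (inj₂ (inj₂ (inj₂ (inj₂ (inj₂ (inj₂ p))))))

Invariant : (Tuple4 → Set) → Set
Invariant P = ∀ {t t′} → Equiv t t′ → P t → P t′

invariant : {P : Tuple4 → Set} →
  (∀ t → P t → P (rot t)) → (∀ t → P t → P (rev t)) → Invariant P
invariant ρ σ (same refl)  p = p
invariant ρ σ (rot¹ refl)  p = ρ _ p
invariant ρ σ (rot² refl)  p = ρ _ (ρ _ p)
invariant ρ σ (rot³ refl)  p = ρ _ (ρ _ (ρ _ p))
invariant ρ σ (flip⁰ refl) p = σ _ p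
invariant ρ σ (flip¹ refl) p = ρ _ (σ _ p)
invariant ρ σ (flip² refl) p = ρ _ (ρ _ (σ _ p))
invariant ρ σ (flip³ refl) p = ρ _ (ρ _ (ρ _ (σ _ p)))

-- Equiv is an equivalence relation.  The group laws (rot⁴ = id, rev² = id,
-- rev ∘ rot = rot³ ∘ rev) hold definitionally thanks to η for tuples.
Equiv-refl : ∀ t → Equiv t t
Equiv-refl t = same refl

Equiv-sym : ∀ {t t′} → Equiv t t′ → Equiv t′ t
Equiv-sym (same refl)  = same refl
Equiv-sym (rot¹ refl)  = rot³ refl
Equiv-sym (rot² refl)  = rot² refl
Equiv-sym (rot³ refl)  = rot¹ refl
Equiv-sym (flip⁰ refl) = flip⁰ refl
Equiv-sym (flip¹ refl) = flip¹ refl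
Equiv-sym (flip² refl) = flip² refl
Equiv-sym (flip³ refl) = flip³ refl

Equiv-trans : ∀ {t t′ t″} → Equiv t t′ → Equiv t′ t″ → Equiv t t″
Equiv-trans {t} p q = invariant {Equiv t} then-rot then-rev q p
  where
  then-rot : ∀ u → Equiv t u → Equiv t (rot u)
  then-rot _ (same refl)  = rot¹ refl
  then-rot _ (rot¹ refl)  = rot² refl
  then-rot _ (rot² refl)  = rot³ refl
  then-rot _ (rot³ refl)  = same refl
  then-rot _ (flip⁰ refl) = flip¹ refl
  then-rot _ (flip¹ refl) = flip² refl
  then-rot _ (flip² refl) = flip³ refl
  then-rot _ (flip³ refl) = flip⁰ refl
  then-rev : ∀ u → Equiv t u → Equiv t (rev u)
  then-rev _ (same refl)  = flip⁰ refl
  then-rev _ (rot¹ refl)  = flip³ refl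
  then-rev _ (rot² refl)  = flip² refl
  then-rev _ (rot³ refl)  = flip¹ refl
  then-rev _ (flip⁰ refl) = same refl
  then-rev _ (flip¹ refl) = rot³ refl
  then-rev _ (flip² refl) = rot² refl
  then-rev _ (flip³ refl) = rot¹ refl

Apart : (Tuple4 → Set) → (Tuple4 → Set) → Set
Apart P Q = ∀ {x y} → P x → Q y → ¬ Equiv x y

separated : {P Q : Tuple4 → Set} → Invariant Q → (∀ {t} → P t → Q t → ⊥) → Apart P Q × Apart Q P
separated Q-inv disjoint =
  (λ p q x~y → disjoint p (Q-inv (Equiv-sym x~y) q)) , (λ q p x~y → disjoint p (Q-inv x~y q))

map4 : (ℕ → ℕ) → Tuple4 → Tuple4
map4 f (a , b , c , d) = f a , f b , f c , f d

Equiv-map4 : ∀ f {t t′} → Equiv t t′ → Equiv (map4 f t) (map4 f t′)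
Equiv-map4 f (same refl)  = same refl
Equiv-map4 f (rot¹ refl)  = rot¹ refl
Equiv-map4 f (rot² refl)  = rot² refl
Equiv-map4 f (rot³ refl)  = rot³ refl
Equiv-map4 f (flip⁰ refl) = flip⁰ refl
Equiv-map4 f (flip¹ refl) = flip¹ refl
Equiv-map4 f (flip² refl) = flip² refl
Equiv-map4 f (flip³ refl) = flip³ refl

Equiv-unmap4 : ∀ {f} → (∀ {x y} → f x ≡ f y → x ≡ y) →
  ∀ {t t′} → Equiv (map4 f t) (map4 f t′) → Equiv t t′
Equiv-unmap4 {f} f-inj = go
  where
  map4-inj : ∀ {t t′} → map4 f t ≡ map4 f t′ → t ≡ t′
  map4-inj {_ , _ , _ , _} {_ , _ , _ , _} p
    with refl ← f-inj (cong (λ (a , _) → a) p)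
       | refl ← f-inj (cong (λ (_ , b , _) → b) p)
       | refl ← f-inj (cong (λ (_ , _ , c , _) → c) p)
       | refl ← f-inj (cong (λ (_ , _ , _ , d) → d) p) = refl
  go : ∀ {t t′} → Equiv (map4 f t) (map4 f t′) → Equiv t t′
  go (same p)  = same (map4-inj p)
  go (rot¹ p)  = rot¹ (map4-inj p)
  go (rot² p)  = rot² (map4-inj p)
  go (rot³ p)  = rot³ (map4-inj p)
  go (flip⁰ p) = flip⁰ (map4-inj p)
  go (flip¹ p) = flip¹ (map4-inj p)
  go (flip² p) = flip² (map4-inj p)
  go (flip³ p) = flip³ (map4-inj p)

-- k pairwise R-inequivalent elements of P meeting every R-class of P;
-- for an equivalence relation R this says that P has exactly k classes.
record Transversal {X : Set} (R : X → X → Set) (P : X → Set) (k : ℕ) : Set where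
  field
    rep        : Fin k → X
    rep-in     : ∀ i → P (rep i)
    rep-apart  : ∀ i j → R (rep i) (rep j) → i ≡ j
    rep-covers : ∀ x → P x → ∃ λ i → R x (rep i)
open Transversal

module _ {X : Set} {R : X → X → Set} where

  transversal-empty : {P : X → Set} → (∀ x → ¬ P x) → Transversal R P 0
  transversal-empty ¬P = record
    { rep = λ () ; rep-in = λ () ; rep-apart = λ () ; rep-covers = λ x p → ⊥-elim (¬P x p) }

  transversal-cong : {P Q : X → Set} {k : ℕ} →
    (∀ x → P x → Q x) → (∀ x → Q x → P x) → Transversal R P k → Transversal R Q k
  transversal-cong P⇒Q Q⇒P T = record
    { rep = rep T ; rep-in = λ i → P⇒Q _ (rep-in T i) ; rep-apart = rep-apart T
    ; rep-covers = λ x q → rep-covers T x (Q⇒P x q) }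

  transversal-⊎ : {P Q : X → Set} {k l : ℕ} →
    (∀ {x y} → P x → Q y → ¬ R x y) → (∀ {x y} → Q x → P y → ¬ R x y) →
    Transversal R P k → Transversal R Q l → Transversal R (λ x → P x ⊎ Q x) (k + l)
  transversal-⊎ {P} {Q} {k} {l} PQ QP S T = record
    { rep = rep′ ; rep-in = rep′-in ; rep-apart = rep′-apart ; rep-covers = rep′-covers }
    where
    rep′ : Fin (k + l) → X
    rep′ i = [ rep S , rep T ]′ (splitAt k i)
    rep′-in : ∀ i → P (rep′ i) ⊎ Q (rep′ i)
    rep′-in i with splitAt k i
    ... | inj₁ a = inj₁ (rep-in S a)
    ... | inj₂ b = inj₂ (rep-in T b)
    rep′-apart : ∀ i j → R (rep′ i) (rep′ j) → i ≡ j
    rep′-apart i j r with splitAt k i in ei | splitAt k j in ej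
    ... | inj₁ a | inj₁ b = trans (sym (splitAt⁻¹-↑ˡ ei)) (trans (cong (_↑ˡ l) (rep-apart S a b r)) (splitAt⁻¹-↑ˡ ej))
    ... | inj₁ a | inj₂ b = ⊥-elim (PQ (rep-in S a) (rep-in T b) r)
    ... | inj₂ a | inj₁ b = ⊥-elim (QP (rep-in T a) (rep-in S b) r)
    ... | inj₂ a | inj₂ b = trans (sym (splitAt⁻¹-↑ʳ ei)) (trans (cong (k ↑ʳ_) (rep-apart T a b r)) (splitAt⁻¹-↑ʳ ej))
    rep′-covers : ∀ x → P x ⊎ Q x → ∃ λ i → R x (rep′ i)
    rep′-covers x (inj₁ p) with rep-covers S x p
    ... | a , r = a ↑ˡ l , subst (R x) (cong [ rep S , rep T ]′ (sym (splitAt-↑ˡ k a l))) r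
    rep′-covers x (inj₂ q) with rep-covers T x q
    ... | b , r = k ↑ʳ b , subst (R x) (cong [ rep S , rep T ]′ (sym (splitAt-↑ʳ k l b))) r

transversal-map : {X Y : Set} {R : X → X → Set} {R′ : Y → Y → Set}
  {P : X → Set} {Q : Y → Set} {k : ℕ} (g : X → Y) →
  (∀ {x y z} → R′ x y → R′ y z → R′ x z) →
  (∀ {x y} → R x y → R′ (g x) (g y)) →
  (∀ {x y} → P x → P y → R′ (g x) (g y) → R x y) →
  (∀ x → P x → Q (g x)) →
  (∀ y → Q y → ∃ λ x → P x × R′ y (g x)) →
  Transversal R P k → Transversal R′ Q k
transversal-map {R′ = R′} {Q = Q} {k} g R′-trans preserve reflect P⇒Q reach T = record
  { rep = λ i → g (rep T i)
  ; rep-in = λ i → P⇒Q _ (rep-in T i)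
  ; rep-apart = λ i j r → rep-apart T i j (reflect (rep-in T i) (rep-in T j) r)
  ; rep-covers = covers }
  where
  covers : ∀ y → Q y → ∃ λ (i : Fin k) → R′ y (g (rep T i))
  covers y q with reach y q
  ... | x , p , y~gx with rep-covers T x p
  ...   | i , x~rep = i , R′-trans y~gx (preserve x~rep)

-- For R = _≡_ a transversal is an enumeration of P without repetition.
transversal-singleton : {X : Set} (v : X) → Transversal _≡_ (_≡ v) 1
transversal-singleton v = record
  { rep = λ _ → v ; rep-in = λ _ → refl ; rep-apart = λ { zero zero _ → refl }
  ; rep-covers = λ x x≡v → zero , x≡v }

transversal-image : {X Y : Set} {P : X → Set} {Q : Y → Set} {k : ℕ} (g : X → Y) →
  (∀ {x y} → P x → P y → g x ≡ g y → x ≡ y) →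
  (∀ x → P x → Q (g x)) →
  (∀ y → Q y → ∃ λ x → P x × y ≡ g x) →
  Transversal _≡_ P k → Transversal _≡_ Q k
transversal-image g = transversal-map g trans (cong g)

transversal-canonical : {P C : Tuple4 → Set} {k : ℕ} →
  (∀ {t t′} → C t → C t′ → Equiv t t′ → t ≡ t′) →
  (∀ t → ∃ λ t′ → Equiv t t′ × C t′) →
  Invariant P →
  Transversal _≡_ (λ t → P t × C t) k → Transversal Equiv P k
transversal-canonical {P} {C} {k} unique exists P-inv T = record
  { rep = rep T
  ; rep-in = λ i → proj₁ (rep-in T i)
  ; rep-apart = λ i j r → rep-apart T i j (unique (proj₂ (rep-in T i)) (proj₂ (rep-in T j)) r)
  ; rep-covers = covers }
  where
  covers : ∀ t → P t → ∃ λ (i : Fin k) → Equiv t (rep T i)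
  covers t p with exists t
  ... | t′ , t~t′ , c with rep-covers T t′ (P-inv t~t′ p , c)
  ...   | i , refl = i , t~t′

numClasses : ∀ {n k} → Transversal Equiv (IsQuadTuple n) k → NumClasses n k
numClasses T =
  (λ i → rep T i , rep-in T i) , rep-apart T , λ (t , q) → rep-covers T t q

tuple-≡ : ∀ {a b c d a′ b′ c′ d′ : ℕ} → a ≡ a′ → b ≡ b′ → c ≡ c′ → d ≡ d′ →
  _≡_ {A = Tuple4} (a , b , c , d) (a′ , b′ , c′ , d′)
tuple-≡ refl refl refl refl = refl

module Canonical
  (_≼_ : ℕ → ℕ → Set)
  (≼-trans : ∀ {x y z} → x ≼ y → y ≼ z → x ≼ z)
  (≼-antisym : ∀ {x y} → x ≼ y → y ≼ x → x ≡ y)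
  (≼-total : ∀ x y → x ≼ y ⊎ y ≼ x) where

  Canonical : Tuple4 → Set
  Canonical (a , b , c , d) = b ≼ a × d ≼ b × c ≼ a × (b ≡ a → d ≼ c)

  canonical-unique : ∀ {t t′} → Canonical t → Canonical t′ → Equiv t t′ → t ≡ t′
  canonical-unique _ _ (same refl) = refl
  canonical-unique {a , b , c , d} (b≼a , d≼b , c≼a , tie) (c≼b , a≼c , _ , tie′) (rot¹ refl) =
    tuple-≡ (sym b≡a) (trans b≡a (sym c≡a)) (trans c≡a (sym d≡a)) d≡a
    where
    c≡a : c ≡ a
    c≡a = ≼-antisym c≼a a≼c
    b≡a : b ≡ a
    b≡a = ≼-antisym b≼a (≼-trans a≼c c≼b)
    d≡a : d ≡ a
    d≡a = ≼-antisym (≼-trans (tie b≡a) c≼a) (tie′ (trans c≡a (sym b≡a)))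
  canonical-unique {a , b , c , d} (_ , d≼b , c≼a , _) (_ , b≼d , a≼c , _) (rot² refl) =
    tuple-≡ (sym (≼-antisym c≼a a≼c)) (≼-antisym b≼d d≼b) (≼-antisym c≼a a≼c) (sym (≼-antisym b≼d d≼b))
  canonical-unique {a , b , c , d} (b≼a , d≼b , _ , tie) (a≼d , _ , b≼d , tie′) (rot³ refl) =
    tuple-≡ a≡d (trans b≡d (sym a≡d)) (trans c≡d (sym b≡d)) (sym c≡d)
    where
    a≡d : a ≡ d
    a≡d = ≼-antisym a≼d (≼-trans d≼b b≼a)
    b≡d : b ≡ d
    b≡d = ≼-antisym b≼d d≼b
    c≡d : c ≡ d
    c≡d = ≼-antisym (≼-trans (tie′ a≡d) b≼d) (tie (trans b≡d (sym a≡d)))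
  canonical-unique {a , b , c , d} (b≼a , d≼b , c≼a , _) (c≼d , a≼c , b≼d , _) (flip⁰ refl) =
    tuple-≡ (trans (sym c≡a) c≡d) (trans b≡d (sym c≡d)) (trans c≡d (sym b≡d)) (trans (sym c≡d) c≡a)
    where
    c≡a : c ≡ a
    c≡a = ≼-antisym c≼a a≼c
    c≡d : c ≡ d
    c≡d = ≼-antisym c≼d (≼-trans (≼-trans d≼b b≼a) a≼c)
    b≡d : b ≡ d
    b≡d = ≼-antisym b≼d d≼b
  canonical-unique {a , b , c , d} (_ , _ , c≼a , _) (_ , _ , a≼c , _) (flip¹ refl) =
    tuple-≡ (sym (≼-antisym c≼a a≼c)) refl (≼-antisym c≼a a≼c) refl
  canonical-unique {a , b , c , d} (b≼a , _ , _ , tie) (a≼b , _ , _ , tie′) (flip² refl) =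
    tuple-≡ a≡b (sym a≡b) (≼-antisym (tie′ a≡b) (tie (sym a≡b))) (≼-antisym (tie (sym a≡b)) (tie′ a≡b))
    where
    a≡b : a ≡ b
    a≡b = ≼-antisym a≼b b≼a
  canonical-unique {a , b , c , d} (_ , d≼b , _ , _) (_ , b≼d , _ , _) (flip³ refl) =
    tuple-≡ refl (≼-antisym b≼d d≼b) refl (sym (≼-antisym b≼d d≼b))

  LargestFirst : Tuple4 → Set
  LargestFirst (a , b , c , d) = b ≼ a × c ≼ a × d ≼ a

  largest-first : ∀ t → ∃ λ t′ → Equiv t t′ × LargestFirst t′
  largest-first (a , b , c , d) with ≼-total b a | ≼-total d c
  ... | inj₁ b≼a | inj₁ d≼c with ≼-total c a
  ...   | inj₁ c≼a = _ , same refl , b≼a , c≼a , ≼-trans d≼c c≼a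
  ...   | inj₂ a≼c = _ , rot² refl , d≼c , a≼c , ≼-trans b≼a a≼c
  largest-first (a , b , c , d) | inj₁ b≼a | inj₂ c≼d with ≼-total d a
  ...   | inj₁ d≼a = _ , same refl , b≼a , ≼-trans c≼d d≼a , d≼a
  ...   | inj₂ a≼d = _ , rot³ refl , a≼d , ≼-trans b≼a a≼d , c≼d
  largest-first (a , b , c , d) | inj₂ a≼b | inj₁ d≼c with ≼-total c b
  ...   | inj₁ c≼b = _ , rot¹ refl , c≼b , ≼-trans d≼c c≼b , a≼b
  ...   | inj₂ b≼c = _ , rot² refl , d≼c , ≼-trans a≼b b≼c , b≼c
  largest-first (a , b , c , d) | inj₂ a≼b | inj₂ c≼d with ≼-total d b
  ...   | inj₁ d≼b = _ , rot¹ refl , ≼-trans c≼d d≼b , d≼b , a≼b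
  ...   | inj₂ b≼d = _ , rot³ refl , ≼-trans a≼b b≼d , b≼d , c≼d

  oriented : ∀ t → LargestFirst t → ∃ λ t′ → Equiv t t′ × LargestFirst t′ × (let (_ , b , _ , d) = t′ in d ≼ b)
  oriented (a , b , c , d) (b≼a , c≼a , d≼a) with ≼-total d b
  ... | inj₁ d≼b = _ , same refl , (b≼a , c≼a , d≼a) , d≼b
  ... | inj₂ b≼d = _ , flip³ refl , (d≼a , c≼a , b≼a) , b≼d

  tie-broken : ∀ t → LargestFirst t → (let (_ , b , _ , d) = t in d ≼ b) → ∃ λ t′ → Equiv t t′ × Canonical t′
  tie-broken (a , b , c , d) (b≼a , c≼a , d≼a) d≼b with ≼-total d c | b ≟ a
  ... | inj₁ d≼c | _     = _ , same refl , b≼a , d≼b , c≼a , λ _ → d≼c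
  ... | inj₂ _   | no b≢a = _ , same refl , b≼a , d≼b , c≼a , λ b≡a → contradiction b≡a b≢a
  ... | inj₂ c≼d | yes refl = _ , flip² refl , b≼a , c≼a , d≼a , λ _ → c≼d

  canonical-exists : ∀ t → ∃ λ t′ → Equiv t t′ × Canonical t′
  canonical-exists t with largest-first t
  ... | t₁ , t~t₁ , L₁ with oriented t₁ L₁
  ...   | t₂ , t₁~t₂ , L₂ , o₂ with tie-broken t₂ L₂ o₂
  ...     | t₃ , t₂~t₃ , C₃ = t₃ , Equiv-trans t~t₁ (Equiv-trans t₁~t₂ t₂~t₃) , C₃

module Longest = Canonical _≤_ ≤-trans ≤-antisym ≤-total
module Shortest = Canonical (λ x y → y ≤ x) (λ p q → ≤-trans q p) (λ p q → ≤-antisym q p) (λ x y → ≤-total y x)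

Pair : ℕ → ℕ × ℕ → Set
Pair s (e , c) = 1 ≤ c × e + c ≡ s

pairs : ∀ s → Transversal _≡_ (Pair s) s
pairs zero = transversal-empty λ { (e , suc c) (_ , sum) → contradiction sum (m+1+n≢0 e) }
pairs (suc s) =
  transversal-cong join split
    (transversal-⊎ (λ { refl (2≤1 , _) refl → 1+n≰n 2≤1 }) (λ { (2≤1 , _) refl refl → 1+n≰n 2≤1 })
      (transversal-singleton (s , 1))
      (transversal-image raise (λ _ _ → raise-injective) raised reach (pairs s)))
  where
  raise : ℕ × ℕ → ℕ × ℕ
  raise (e , c) = e , suc c
  raise-injective : ∀ {x y} → raise x ≡ raise y → x ≡ y
  raise-injective {_ , _} {_ , _} refl = refl
  Raised : ℕ × ℕ → Set
  Raised (e , c) = 2 ≤ c × Pair (suc s) (e , c)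
  raised : ∀ x → Pair s x → Raised (raise x)
  raised (e , c) (1≤c , sum) = s≤s 1≤c , s≤s z≤n , trans (+-suc e c) (cong suc sum)
  reach : ∀ y → Raised y → ∃ λ x → Pair s x × y ≡ raise x
  reach (e , suc c) (s≤s 1≤c , _ , sum) = (e , c) , (1≤c , suc-injective (trans (sym (+-suc e c)) sum)) , refl
  join : ∀ x → x ≡ (s , 1) ⊎ Raised x → Pair (suc s) x
  join _ (inj₁ refl) = s≤s z≤n , +-comm s 1
  join _ (inj₂ (_ , p)) = p
  split : ∀ x → Pair (suc s) x → x ≡ (s , 1) ⊎ Raised x
  split (e , suc zero) (_ , sum) = inj₁ (cong (_, 1) (suc-injective (trans (+-comm 1 e) sum)))
  split (e , suc (suc c)) p = inj₂ (s≤s (s≤s z≤n) , p)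

-- Triples (d , e , c) with d, c ≥ 1 and 2d + e + c = s.  Splitting off d = 1
-- gives the recursion  triCount (s + 2) = s + triCount s.
Triple : ℕ → ℕ × ℕ × ℕ → Set
Triple s (d , e , c) = 1 ≤ d × 1 ≤ c × d + d + e + c ≡ s

triCount : ℕ → ℕ
triCount (suc (suc s)) = s + triCount s
triCount _ = 0

triple-d+e : ∀ {s d e c} → Triple s (d , e , c) → d + e + 2 ≤ s
triple-d+e {s} {d} {e} {c} (1≤d , 1≤c , sum) =
  ≤-trans (+-monoʳ-≤ (d + e) (+-mono-≤ 1≤d 1≤c)) (≤-reflexive (trans (regroup d e c) sum))
  where
  regroup : ∀ d e c → d + e + (d + c) ≡ d + d + e + c
  regroup = solve-∀

triple-c : ∀ {s d e c} → Triple s (d , e , c) → c + 2 ≤ s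
triple-c {s} {d} {e} {c} (1≤d , 1≤c , sum) =
  ≤-trans (+-monoʳ-≤ c (≤-trans (+-mono-≤ 1≤d 1≤d) (m≤m+n (d + d) e))) (≤-reflexive (trans (regroup d e c) sum))
  where
  regroup : ∀ d e c → c + (d + d + e) ≡ d + d + e + c
  regroup = solve-∀

triple-d : ∀ {s d e c} → Triple s (d , e , c) → d + 2 ≤ s
triple-d {d = d} {e} t = ≤-trans (+-monoˡ-≤ 2 (m≤m+n d e)) (triple-d+e t)

triple-large : ∀ {s} x → Triple s x → 3 ≤ s
triple-large (d , e , c) t@(_ , 1≤c , _) = ≤-trans (+-monoˡ-≤ 2 1≤c) (triple-c t)

triples : ∀ s → Transversal _≡_ (Triple s) (triCount s)
triples zero = transversal-empty λ x t → contradiction (triple-large x t) λ ()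
triples (suc zero) = transversal-empty λ x t → contradiction (triple-large x t) λ { (s≤s ()) }
triples (suc (suc s)) =
  transversal-cong join split
    (transversal-⊎ (λ { (refl , _) (2≤1 , _) refl → 1+n≰n 2≤1 }) (λ { (2≤1 , _) (refl , _) refl → 1+n≰n 2≤1 })
      (transversal-image first (λ _ _ → first-injective) firsts reach₁ (pairs s))
      (transversal-image raise (λ _ _ → raise-injective) raised reach₂ (triples s)))
  where
  Q₁ Q₂ : ℕ × ℕ × ℕ → Set
  Q₁ (d , e , c) = d ≡ 1 × Triple (suc (suc s)) (d , e , c)
  Q₂ (d , e , c) = 2 ≤ d × Triple (suc (suc s)) (d , e , c)
  first : ℕ × ℕ → ℕ × ℕ × ℕ
  first (e , c) = 1 , e , c
  first-injective : ∀ {x y} → first x ≡ first y → x ≡ y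
  first-injective {_ , _} {_ , _} refl = refl
  firsts : ∀ x → Pair s x → Q₁ (first x)
  firsts (e , c) (1≤c , sum) = refl , s≤s z≤n , 1≤c , cong (λ n → 2 + n) sum
  reach₁ : ∀ y → Q₁ y → ∃ λ x → Pair s x × y ≡ first x
  reach₁ (.1 , e , c) (refl , _ , 1≤c , sum) = (e , c) , (1≤c , suc-injective (suc-injective sum)) , refl
  raise : ℕ × ℕ × ℕ → ℕ × ℕ × ℕ
  raise (d , e , c) = suc d , e , c
  raise-injective : ∀ {x y} → raise x ≡ raise y → x ≡ y
  raise-injective {_ , _ , _} {_ , _ , _} refl = refl
  raise-sum : ∀ d e c → suc d + suc d + e + c ≡ 2 + (d + d + e + c)
  raise-sum = solve-∀
  raised : ∀ x → Triple s x → Q₂ (raise x)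
  raised (d , e , c) (1≤d , 1≤c , sum) = s≤s 1≤d , s≤s z≤n , 1≤c , trans (raise-sum d e c) (cong (λ n → 2 + n) sum)
  reach₂ : ∀ y → Q₂ y → ∃ λ x → Triple s x × y ≡ raise x
  reach₂ (suc d , e , c) (s≤s 1≤d , _ , 1≤c , sum) =
    (d , e , c) , (1≤d , 1≤c , suc-injective (suc-injective (trans (sym (raise-sum d e c)) sum))) , refl
  join : ∀ x → Q₁ x ⊎ Q₂ x → Triple (suc (suc s)) x
  join _ (inj₁ (_ , t)) = t
  join _ (inj₂ (_ , t)) = t
  split : ∀ x → Triple (suc (suc s)) x → Q₁ x ⊎ Q₂ x
  split (suc zero , e , c) t = inj₁ (refl , t)
  split (suc (suc d) , e , c) t = inj₂ (s≤s (s≤s z≤n) , t)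

All4 : (ℕ → Set) → Tuple4 → Set
All4 p (a , b , c , d) = p a × p b × p c × p d

Some4 : (ℕ → Set) → Tuple4 → Set
Some4 p (a , b , c , d) = p a ⊎ p b ⊎ p c ⊎ p d

All4-invariant : ∀ p → Invariant (All4 p)
All4-invariant p = invariant (λ _ (x , y , z , w) → y , z , w , x) (λ _ (x , y , z , w) → w , z , y , x)

Some4-invariant : ∀ p → Invariant (Some4 p)
Some4-invariant p = invariant left right
  where
  left : ∀ t → Some4 p t → Some4 p (rot t)
  left _ (inj₁ x)               = inj₂ (inj₂ (inj₂ x))
  left _ (inj₂ (inj₁ x))        = inj₁ x
  left _ (inj₂ (inj₂ (inj₁ x))) = inj₂ (inj₁ x)
  left _ (inj₂ (inj₂ (inj₂ x))) = inj₂ (inj₂ (inj₁ x))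
  right : ∀ t → Some4 p t → Some4 p (rev t)
  right _ (inj₁ x)               = inj₂ (inj₂ (inj₂ x))
  right _ (inj₂ (inj₁ x))        = inj₂ (inj₂ (inj₁ x))
  right _ (inj₂ (inj₂ (inj₁ x))) = inj₂ (inj₁ x)
  right _ (inj₂ (inj₂ (inj₂ x))) = inj₁ x

all4-map : ∀ {p q : ℕ → Set} → (∀ {x} → p x → q x) → ∀ t → All4 p t → All4 q t
all4-map f _ (x , y , z , w) = f x , f y , f z , f w

all4-zip : ∀ {p q r : ℕ → Set} → (∀ {x} → p x → q x → r x) → ∀ t → All4 p t → All4 q t → All4 r t
all4-zip f _ (x , y , z , w) (x′ , y′ , z′ , w′) = f x x′ , f y y′ , f z z′ , f w w′

some4-zip : ∀ {p q r : ℕ → Set} → (∀ {x} → p x → q x → r x) → ∀ t → All4 p t → Some4 q t → Some4 r t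
some4-zip f _ (x , _ , _ , _) (inj₁ y)               = inj₁ (f x y)
some4-zip f _ (_ , x , _ , _) (inj₂ (inj₁ y))        = inj₂ (inj₁ (f x y))
some4-zip f _ (_ , _ , x , _) (inj₂ (inj₂ (inj₁ y))) = inj₂ (inj₂ (inj₁ (f x y)))
some4-zip f _ (_ , _ , _ , x) (inj₂ (inj₂ (inj₂ y))) = inj₂ (inj₂ (inj₂ (f x y)))

all-some : ∀ {p q : ℕ → Set} t → All4 p t → Some4 q t → ∃ λ x → p x × q x
all-some _ (x , _ , _ , _) (inj₁ y)               = _ , x , y
all-some _ (_ , x , _ , _) (inj₂ (inj₁ y))        = _ , x , y
all-some _ (_ , _ , x , _) (inj₂ (inj₂ (inj₁ y))) = _ , x , y
all-some _ (_ , _ , _ , x) (inj₂ (inj₂ (inj₂ y))) = _ , x , y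

all-or-some : ∀ {p : ℕ → Set} → (∀ x → Dec (p x)) → ∀ t → All4 p t ⊎ Some4 (λ x → ¬ p x) t
all-or-some p? (a , b , c , d) with p? a | p? b | p? c | p? d
... | yes x | yes y | yes z | yes w = inj₁ (x , y , z , w)
... | no x  | _     | _     | _     = inj₂ (inj₁ x)
... | yes _ | no y  | _     | _     = inj₂ (inj₂ (inj₁ y))
... | yes _ | yes _ | no z  | _     = inj₂ (inj₂ (inj₂ (inj₁ z)))
... | yes _ | yes _ | yes _ | no w  = inj₂ (inj₂ (inj₂ (inj₂ w)))

perimeter : Tuple4 → ℕ
perimeter (a , b , c , d) = a + b + c + d

perimeter-invariant : ∀ n → Invariant (λ t → perimeter t ≡ n)
perimeter-invariant n = invariant (λ (a , b , c , d) p → trans (rotated a b c d) p) (λ (a , b , c , d) p → trans (reversed a b c d) p)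
  where
  rotated : ∀ a b c d → b + c + d + a ≡ a + b + c + d
  rotated = solve-∀
  reversed : ∀ a b c d → d + c + b + a ≡ a + b + c + d
  reversed = solve-∀

IsQuadTuple-invariant : ∀ n → Invariant (IsQuadTuple n)
IsQuadTuple-invariant n t~t′ (positive , sum , bounded) =
  All4-invariant _ t~t′ positive , perimeter-invariant n t~t′ sum , All4-invariant _ t~t′ bounded

quad-perimeter : ∀ {n} t → IsQuadTuple n t → 4 ≤ n
quad-perimeter (a , b , c , d) ((1≤a , 1≤b , 1≤c , 1≤d) , sum , _) =
  ≤-trans (+-mono-≤ (+-mono-≤ (+-mono-≤ 1≤a 1≤b) 1≤c) 1≤d) (≤-reflexive sum)

∸-by-sum : ∀ {x y z} → x + y ≡ z → z ∸ x ≡ y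
∸-by-sum {x} {y} refl = m+n∸m≡n x y

module Perimeter (N h : ℕ) (h-below : 2 * h < N) (h-top : N ≤ 2 + 2 * h) where

  side-≤ : ∀ {x} → 2 * x < N → x ≤ h
  side-≤ {x} 2x<N =
    ≤-pred (*-cancelˡ-< 2 x (suc h) (<-≤-trans 2x<N (≤-trans h-top (≤-reflexive (sym (*-suc 2 h))))))

  side-< : ∀ {x} → x ≤ h → 2 * x < N
  side-< x≤h = ≤-<-trans (*-monoʳ-≤ 2 x≤h) h-below

  Interior UnitSide LongSide : Tuple4 → Set
  Interior t = IsQuadTuple N t × All4 (λ x → 1 < x × x < h) t
  UnitSide t = IsQuadTuple N t × All4 (_< h) t × Some4 (_≡ 1) t
  LongSide t = IsQuadTuple N t × Some4 (_≡ h) t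

  UnitSide-invariant : Invariant UnitSide
  UnitSide-invariant t~t′ (q , short , one) =
    IsQuadTuple-invariant N t~t′ q , All4-invariant _ t~t′ short , Some4-invariant _ t~t′ one

  LongSide-invariant : Invariant LongSide
  LongSide-invariant t~t′ (q , long) = IsQuadTuple-invariant N t~t′ q , Some4-invariant _ t~t′ long

  decompose : ∀ t → IsQuadTuple N t → Interior t ⊎ (UnitSide t ⊎ LongSide t)
  decompose t q@(positive , _ , bounded) with all-or-some {p = _< h} (λ x → x <? h) t
  ... | inj₂ some-long =
    inj₂ (inj₂ (q , some4-zip {r = _≡ h} (λ 2x<N x≮h → ≤-antisym (side-≤ 2x<N) (≮⇒≥ x≮h)) t bounded some-long))
  ... | inj₁ all-short with all-or-some {p = 1 <_} (λ x → 1 <? x) t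
  ...   | inj₁ all-large = inj₁ (q , all4-zip {r = λ x → 1 < x × x < h} _,_ t all-large all-short)
  ...   | inj₂ some-unit =
    inj₂ (inj₁ (q , all-short , some4-zip {r = _≡ 1} (λ 1≤x 1≮x → ≤-antisym (≮⇒≥ 1≮x) 1≤x) t positive some-unit))

  recompose : ∀ t → Interior t ⊎ (UnitSide t ⊎ LongSide t) → IsQuadTuple N t
  recompose t (inj₁ (q , _))        = q
  recompose t (inj₂ (inj₁ (q , _))) = q
  recompose t (inj₂ (inj₂ (q , _))) = q

  short-not-long : ∀ t → All4 (_< h) t → Some4 (_≡ h) t → ⊥
  short-not-long t short long with all-some {p = _< h} {q = _≡ h} t short long
  ... | _ , x<h , refl = <-irrefl refl x<h

  unit-not-long : ∀ {t} → UnitSide t → LongSide t → ⊥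
  unit-not-long {t} (_ , short , _) (_ , long) = short-not-long t short long

  interior-not-unit-or-long : ∀ {t} → Interior t → UnitSide t ⊎ LongSide t → ⊥
  interior-not-unit-or-long {t} (_ , interior) (inj₁ (_ , _ , one))
    with all-some {p = λ x → 1 < x × x < h} {q = _≡ 1} t interior one
  ... | _ , (1<x , _) , refl = <-irrefl refl 1<x
  interior-not-unit-or-long {t} (_ , interior) (inj₂ (_ , long)) =
    short-not-long t (all4-map {p = λ x → 1 < x × x < h} {q = _< h} proj₂ t interior) long

  UnitOrLong-invariant : Invariant (λ t → UnitSide t ⊎ LongSide t)
  UnitOrLong-invariant t~t′ (inj₁ u) = inj₁ (UnitSide-invariant t~t′ u)
  UnitOrLong-invariant t~t′ (inj₂ l) = inj₂ (LongSide-invariant t~t′ l)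

  count-parts : ∀ {k l m} →
    Transversal Equiv Interior k → Transversal Equiv UnitSide l → Transversal Equiv LongSide m →
    Transversal Equiv (IsQuadTuple N) (k + (l + m))
  count-parts I U L =
    transversal-cong recompose decompose
      (transversal-⊎ (proj₁ interior-apart) (proj₂ interior-apart) I
        (transversal-⊎ (proj₁ unit-long-apart) (proj₂ unit-long-apart) U L))
    where
    unit-long-apart : Apart UnitSide LongSide × Apart LongSide UnitSide
    unit-long-apart = separated LongSide-invariant unit-not-long
    interior-apart : Apart Interior (λ t → UnitSide t ⊎ LongSide t) × Apart (λ t → UnitSide t ⊎ LongSide t) Interior
    interior-apart = separated UnitOrLong-invariant interior-not-unit-or-long

  interior-part : ∀ M {k} → N ≡ 4 + M → Transversal Equiv (IsQuadTuple M) k → Transversal Equiv Interior k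
  interior-part M {k} N≡4+M =
    transversal-map (map4 suc) Equiv-trans (Equiv-map4 suc) (λ _ _ → Equiv-unmap4 suc-injective) lengthened reach
    where
    double-plus-two : ∀ x → 2 * (2 + x) ≡ 4 + 2 * x
    double-plus-two = solve-∀
    sum-plus-four : ∀ a b c d → suc a + suc b + suc c + suc d ≡ 4 + (a + b + c + d)
    sum-plus-four = solve-∀
    grow : ∀ {y} → 2 * y < M → suc y < h
    grow {y} 2y<M = ≤-pred (*-cancelˡ-< 2 (2 + y) (suc h) (begin-strict
      2 * (2 + y) ≡⟨ double-plus-two y ⟩
      4 + 2 * y   <⟨ +-monoʳ-< 4 2y<M ⟩
      4 + M       ≡⟨ sym N≡4+M ⟩
      N           ≤⟨ h-top ⟩
      2 + 2 * h   ≡⟨ sym (*-suc 2 h) ⟩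
      2 * suc h   ∎))
      where open ≤-Reasoning
    shrink : ∀ {y} → suc y < h → 2 * y < M
    shrink {y} y+1<h = +-cancelˡ-< 4 (2 * y) M (begin-strict
      4 + 2 * y   ≡⟨ sym (double-plus-two y) ⟩
      2 * (2 + y) ≤⟨ *-monoʳ-≤ 2 y+1<h ⟩
      2 * h       <⟨ h-below ⟩
      N           ≡⟨ N≡4+M ⟩
      4 + M       ∎)
      where open ≤-Reasoning
    interior-side : ∀ {y} → 1 ≤ y → 2 * y < M → 1 < suc y × suc y < h
    interior-side 1≤y 2y<M = s≤s 1≤y , grow 2y<M
    lengthened : ∀ t → IsQuadTuple M t → Interior (map4 suc t)
    lengthened (a , b , c , d) ((pa , pb , pc , pd) , sum , (ba , bb , bc , bd)) =
      ((s≤s z≤n , s≤s z≤n , s≤s z≤n , s≤s z≤n) ,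
       trans (sum-plus-four a b c d) (trans (cong (λ n → 4 + n) sum) (sym N≡4+M)) ,
       (side-< (<⇒≤ (grow ba)) , side-< (<⇒≤ (grow bb)) , side-< (<⇒≤ (grow bc)) , side-< (<⇒≤ (grow bd)))) ,
      (interior-side pa ba , interior-side pb bb , interior-side pc bc , interior-side pd bd)
    reach : ∀ t → Interior t → ∃ λ t′ → IsQuadTuple M t′ × Equiv t (map4 suc t′)
    reach (suc a , suc b , suc c , suc d) ((_ , sum , _) , ((s≤s pa , ha) , (s≤s pb , hb) , (s≤s pc , hc) , (s≤s pd , hd))) =
      (a , b , c , d) ,
      ((pa , pb , pc , pd) ,
       +-cancelˡ-≡ 4 _ _ (trans (sym (sum-plus-four a b c d)) (trans sum N≡4+M)) ,
       (shrink ha , shrink hb , shrink hc , shrink hd)) ,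
      Equiv-refl _

  -- Tuples with a side h of perimeter N = h + s correspond to triples for s:
  -- the canonical tuple (h , b , c , d) has b ≥ d and comes from (d , b − d , c).
  module LongSideTriples (s : ℕ) (1≤h : 1 ≤ h) (N≡h+s : N ≡ h + s) where
    open Longest

    s≤h+2 : s ≤ h + 2
    s≤h+2 = +-cancelˡ-≤ h s (h + 2) (begin
      h + s       ≡⟨ sym N≡h+s ⟩
      N           ≤⟨ h-top ⟩
      2 + 2 * h   ≡⟨ two-plus-double h ⟩
      h + (h + 2) ∎)
      where
      open ≤-Reasoning
      two-plus-double : ∀ h → 2 + 2 * h ≡ h + (h + 2)
      two-plus-double = solve-∀

    part≤h : ∀ {x} → x + 2 ≤ s → x ≤ h
    part≤h {x} x+2≤s = +-cancelʳ-≤ 2 x h (≤-trans x+2≤s s≤h+2)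

    place : ℕ × ℕ × ℕ → Tuple4
    place (d , e , c) = h , d + e , c , d

    place-injective : ∀ {x y} → Triple s x → Triple s y → place x ≡ place y → x ≡ y
    place-injective {d , e , c} {d′ , e′ , c′} _ _ p
      with refl ← cong (λ (_ , _ , _ , x) → x) p | refl ← cong (λ (_ , _ , x , _) → x) p =
      cong (λ e → d , e , c) (+-cancelˡ-≡ d e e′ (cong (λ (_ , x , _ , _) → x) p))

    regroup : ∀ h d e c → h + (d + e) + c + d ≡ h + (d + d + e + c)
    regroup = solve-∀

    -- if b = d + e reaches h, the other two sides d, c share at most 2,
    -- so d = 1 ≤ c and the tie is broken correctly
    tie-broken-by-c : ∀ {d e c} → Triple s (d , e , c) → d + e ≡ h → d ≤ c
    tie-broken-by-c {d} {e} {c} (_ , 1≤c , sum) d+e≡h =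
      ≤-trans (+-cancelʳ-≤ 1 d 1 (≤-trans (+-monoʳ-≤ d 1≤c) d+c≤2)) 1≤c
      where
      split-sum : ∀ d e c → d + e + (d + c) ≡ d + d + e + c
      split-sum = solve-∀
      d+c≤2 : d + c ≤ 2
      d+c≤2 = +-cancelˡ-≤ h (d + c) 2 (begin
        h + (d + c)       ≡⟨ cong (_+ (d + c)) (sym d+e≡h) ⟩
        d + e + (d + c)   ≡⟨ trans (split-sum d e c) sum ⟩
        s                 ≤⟨ s≤h+2 ⟩
        h + 2             ∎)
        where open ≤-Reasoning

    placed : ∀ x → Triple s x → LongSide (place x) × Canonical (place x)
    placed (d , e , c) t@(1≤d , 1≤c , sum) =
      (((1≤h , ≤-trans 1≤d (m≤m+n d e) , 1≤c , 1≤d) , perimeter-h ,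
        (side-< ≤-refl , side-< d+e≤h , side-< c≤h , side-< (≤-trans (m≤m+n d e) d+e≤h))) ,
       inj₁ refl) ,
      d+e≤h , m≤m+n d e , c≤h , tie-broken-by-c t
      where
      d+e≤h : d + e ≤ h
      d+e≤h = part≤h (triple-d+e t)
      c≤h : c ≤ h
      c≤h = part≤h (triple-c t)
      perimeter-h : h + (d + e) + c + d ≡ N
      perimeter-h = trans (regroup h d e c) (trans (cong (λ n → h + n) sum) (sym N≡h+s))

    starts-with-h : ∀ {a b c d} → LongSide (a , b , c , d) → Canonical (a , b , c , d) → a ≡ h
    starts-with-h {a} {b} {c} {d} ((_ , _ , (a-bounded , _)) , long) (b≤a , d≤b , c≤a , _)
      with all-some {p = _≤ a} {q = _≡ h} (a , b , c , d) (≤-refl , b≤a , c≤a , ≤-trans d≤b b≤a) long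
    ... | _ , h≤a , refl = ≤-antisym (side-≤ a-bounded) h≤a

    reach : ∀ t → LongSide t × Canonical t → ∃ λ x → Triple s x × t ≡ place x
    reach (a , b , c , d) (L@(((_ , _ , 1≤c , 1≤d) , sum , _) , _) , C@(_ , d≤b , _ , _)) with starts-with-h L C
    ... | refl = (d , b ∸ d , c) , (1≤d , 1≤c , triple-sum) , tuple-≡ refl (sym (m+[n∸m]≡n d≤b)) refl refl
      where
      triple-sum : d + d + (b ∸ d) + c ≡ s
      triple-sum = +-cancelˡ-≡ h _ _ (begin
        h + (d + d + (b ∸ d) + c) ≡⟨ sym (regroup h d (b ∸ d) c) ⟩
        h + (d + (b ∸ d)) + c + d ≡⟨ cong (λ x → h + x + c + d) (m+[n∸m]≡n d≤b) ⟩
        h + b + c + d             ≡⟨ sum ⟩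
        N                         ≡⟨ N≡h+s ⟩
        h + s                     ∎)
        where open ≡-Reasoning

    long-side-part : Transversal Equiv LongSide (triCount s)
    long-side-part =
      transversal-canonical canonical-unique canonical-exists LongSide-invariant
        (transversal-image place place-injective placed reach (triples s))

  -- Tuples with all sides below h and a side 1, of perimeter N with
  -- N + s = 3h + 1, correspond to triples for s by complementing to h:
  -- the canonical tuple (1 , b , c , d) has b ≤ d and comes from
  -- (h − d , d − b , h − c).
  module UnitSideTriples (s : ℕ) (3h+1≡N+s : 3 * h + 1 ≡ N + s) where
    open Shortest

    s≤h : s ≤ h
    s≤h = +-cancelˡ-≤ (suc (2 * h)) s h (begin
      suc (2 * h) + s ≤⟨ +-monoˡ-≤ s h-below ⟩
      N + s           ≡⟨ sym 3h+1≡N+s ⟩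
      3 * h + 1       ≡⟨ three-times h ⟩
      suc (2 * h) + h ∎)
      where
      open ≤-Reasoning
      three-times : ∀ h → 3 * h + 1 ≡ suc (2 * h) + h
      three-times = solve-∀

    part≤h : ∀ {x} → x + 2 ≤ s → x ≤ h
    part≤h {x} x+2≤s = ≤-trans (m≤m+n x 2) (≤-trans x+2≤s s≤h)

    complement-≥2 : ∀ {x} → x + 2 ≤ s → 2 ≤ h ∸ x
    complement-≥2 {x} x+2≤s = m+n≤o⇒m≤o∸n 2 (≤-trans (≤-reflexive (+-comm 2 x)) (≤-trans x+2≤s s≤h))

    complement-< : ∀ {x} → 1 ≤ x → x ≤ h → h ∸ x < h
    complement-< 1≤x x≤h = ∸-monoʳ-< {o = 0} 1≤x x≤h

    three-h : ∀ h → 1 + h + h + h ≡ 3 * h + 1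
    three-h = solve-∀

    complement : ℕ × ℕ × ℕ → Tuple4
    complement (d , e , c) = 1 , h ∸ (d + e) , h ∸ c , h ∸ d

    complement-injective : ∀ {x y} → Triple s x → Triple s y → complement x ≡ complement y → x ≡ y
    complement-injective {d , e , c} {d′ , e′ , c′} t t′ p
      with refl ← ∸-cancelˡ-≡ (part≤h (triple-d t)) (part≤h (triple-d t′)) (cong (λ (_ , _ , _ , x) → x) p)
         | refl ← ∸-cancelˡ-≡ (part≤h (triple-c t)) (part≤h (triple-c t′)) (cong (λ (_ , _ , x , _) → x) p) =
      cong (λ e → d , e , c) (+-cancelˡ-≡ d e e′
        (∸-cancelˡ-≡ (part≤h (triple-d+e t)) (part≤h (triple-d+e t′)) (cong (λ (_ , x , _ , _) → x) p)))

    -- the complemented sides and the parts of the triple add up to 3h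
    complement-perimeter : ∀ {d e c} → Triple s (d , e , c) → 1 + (h ∸ (d + e)) + (h ∸ c) + (h ∸ d) ≡ N
    complement-perimeter {d} {e} {c} t@(_ , _ , sum) = +-cancelʳ-≡ s _ _ (begin
      1 + (h ∸ (d + e)) + (h ∸ c) + (h ∸ d) + s
        ≡⟨ cong (λ n → 1 + (h ∸ (d + e)) + (h ∸ c) + (h ∸ d) + n) (sym sum) ⟩
      1 + (h ∸ (d + e)) + (h ∸ c) + (h ∸ d) + (d + d + e + c)
        ≡⟨ regroup (h ∸ (d + e)) (h ∸ c) (h ∸ d) d e c ⟩
      1 + (h ∸ (d + e) + (d + e)) + (h ∸ c + c) + (h ∸ d + d)
        ≡⟨ cong₂ (λ x y → 1 + x + y + (h ∸ d + d)) (m∸n+n≡m (part≤h (triple-d+e t))) (m∸n+n≡m (part≤h (triple-c t))) ⟩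
      1 + h + h + (h ∸ d + d)
        ≡⟨ cong (λ x → 1 + h + h + x) (m∸n+n≡m (part≤h (triple-d t))) ⟩
      1 + h + h + h
        ≡⟨ three-h h ⟩
      3 * h + 1
        ≡⟨ 3h+1≡N+s ⟩
      N + s ∎)
      where
      open ≡-Reasoning
      regroup : ∀ B C D d e c → 1 + B + C + D + (d + d + e + c) ≡ 1 + (B + (d + e)) + (C + c) + (D + d)
      regroup = solve-∀

    complemented : ∀ x → Triple s x → UnitSide (complement x) × Canonical (complement x)
    complemented (d , e , c) t@(1≤d , 1≤c , _) =
      (((s≤s z≤n , ≤-trans (s≤s z≤n) B≥2 , ≤-trans (s≤s z≤n) C≥2 , ≤-trans (s≤s z≤n) D≥2) ,
         complement-perimeter t ,
         (side-< (<⇒≤ 1<h) , side-< (m∸n≤m h (d + e)) , side-< (m∸n≤m h c) , side-< (m∸n≤m h d))) ,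
        (1<h , complement-< (≤-trans 1≤d (m≤m+n d e)) (part≤h (triple-d+e t)) ,
               complement-< 1≤c (part≤h (triple-c t)) , complement-< 1≤d (part≤h (triple-d t))) ,
        inj₁ refl) ,
      ≤-trans (s≤s z≤n) B≥2 , ∸-monoʳ-≤ h (m≤m+n d e) , ≤-trans (s≤s z≤n) C≥2 ,
      (λ B≡1 → ⊥-elim (1+n≰n (≤-trans B≥2 (≤-reflexive B≡1))))
      where
      B≥2 : 2 ≤ h ∸ (d + e)
      B≥2 = complement-≥2 (triple-d+e t)
      C≥2 : 2 ≤ h ∸ c
      C≥2 = complement-≥2 (triple-c t)
      D≥2 : 2 ≤ h ∸ d
      D≥2 = complement-≥2 (triple-d t)
      1<h : 1 < h
      1<h = ≤-trans B≥2 (m∸n≤m h (d + e))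

    starts-with-1 : ∀ {a b c d} → UnitSide (a , b , c , d) → Canonical (a , b , c , d) → a ≡ 1
    starts-with-1 {a} {b} {c} {d} (((1≤a , _) , _) , _ , one) (a≤b , b≤d , a≤c , _)
      with all-some {p = a ≤_} {q = _≡ 1} (a , b , c , d) (≤-refl , a≤b , a≤c , ≤-trans a≤b b≤d) one
    ... | _ , a≤1 , refl = ≤-antisym a≤1 1≤a

    complement-triple : ∀ {b c d} → b ≤ d → d < h → c < h → 1 + b + c + d ≡ N →
      h ∸ d + (h ∸ d) + (d ∸ b) + (h ∸ c) ≡ s
    complement-triple {b} {c} {d} b≤d d<h c<h sum = +-cancelʳ-≡ N _ _ (begin
      h ∸ d + (h ∸ d) + (d ∸ b) + (h ∸ c) + N
        ≡⟨ cong (λ n → h ∸ d + (h ∸ d) + (d ∸ b) + (h ∸ c) + n) (sym sum) ⟩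
      h ∸ d + (h ∸ d) + (d ∸ b) + (h ∸ c) + (1 + b + c + d)
        ≡⟨ regroup (h ∸ d) (d ∸ b) (h ∸ c) b c d ⟩
      1 + (h ∸ d + d) + (h ∸ d + (b + (d ∸ b))) + (h ∸ c + c)
        ≡⟨ cong (λ x → 1 + (h ∸ d + d) + (h ∸ d + x) + (h ∸ c + c)) (m+[n∸m]≡n b≤d) ⟩
      1 + (h ∸ d + d) + (h ∸ d + d) + (h ∸ c + c)
        ≡⟨ cong₂ (λ x y → 1 + x + x + y) (m∸n+n≡m (<⇒≤ d<h)) (m∸n+n≡m (<⇒≤ c<h)) ⟩
      1 + h + h + h
        ≡⟨ three-h h ⟩
      3 * h + 1
        ≡⟨ trans 3h+1≡N+s (+-comm N s) ⟩
      s + N ∎)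
      where
      open ≡-Reasoning
      regroup : ∀ D E C b c d → D + D + E + C + (1 + b + c + d) ≡ 1 + (D + d) + (D + (b + E)) + (C + c)
      regroup = solve-∀

    reach : ∀ t → UnitSide t × Canonical t → ∃ λ x → Triple s x × t ≡ complement x
    reach (a , b , c , d) (U@((_ , sum , _) , (_ , _ , c<h , d<h) , _) , C@(_ , b≤d , _ , _)) with starts-with-1 U C
    ... | refl =
      (h ∸ d , d ∸ b , h ∸ c) , (m<n⇒0<n∸m d<h , m<n⇒0<n∸m c<h , complement-triple b≤d d<h c<h sum) ,
      tuple-≡ refl (sym (∸-by-sum b-complement)) (sym (m∸[m∸n]≡n (<⇒≤ c<h))) (sym (m∸[m∸n]≡n (<⇒≤ d<h)))
      where
      -- (h − d) + (d − b) + b = h, so complementing d + e gives back b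
      b-complement : h ∸ d + (d ∸ b) + b ≡ h
      b-complement = trans (+-assoc (h ∸ d) (d ∸ b) b)
        (trans (cong (λ x → h ∸ d + x) (trans (+-comm (d ∸ b) b) (m+[n∸m]≡n b≤d))) (m∸n+n≡m (<⇒≤ d<h)))

    unit-side-part : Transversal Equiv UnitSide (triCount s)
    unit-side-part =
      transversal-canonical canonical-unique canonical-exists UnitSide-invariant
        (transversal-image complement complement-injective complemented reach (triples s))

longest-side : ∀ {N h} → N ≡ 1 + 2 * h ⊎ N ≡ 2 + 2 * h → 2 * h < N × N ≤ 2 + 2 * h
longest-side {h = h} (inj₁ refl) = ≤-refl , n≤1+n (1 + 2 * h)
longest-side {h = h} (inj₂ refl) = n≤1+n (1 + 2 * h) , ≤-refl

count-step : ∀ M h s₂ s₃ {k} → 1 ≤ h → 4 + M ≡ 1 + 2 * h ⊎ 4 + M ≡ 2 + 2 * h →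
  3 * h + 1 ≡ (4 + M) + s₂ → 4 + M ≡ h + s₃ →
  Transversal Equiv (IsQuadTuple M) k →
  Transversal Equiv (IsQuadTuple (4 + M)) (k + (triCount s₂ + triCount s₃))
count-step M h s₂ s₃ 1≤h longest unit-sum long-sum T =
  count-parts (interior-part M refl T) (UnitSideTriples.unit-side-part s₂ unit-sum)
    (LongSideTriples.long-side-part s₃ 1≤h long-sum)
  where open Perimeter (4 + M) h (proj₁ (longest-side {h = h} longest)) (proj₂ (longest-side {h = h} longest))

-- The class counts for even perimeters 2j and odd perimeters 2j + 1, as
-- produced by the recursion.
evenCount : ℕ → ℕ
evenCount (suc (suc j)) = evenCount j + (triCount j + triCount (3 + j))
evenCount _ = 0

oddCount : ℕ → ℕ
oddCount (suc (suc j)) = oddCount j + (triCount (2 + j) + triCount (3 + j))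
oddCount _ = 0

no-small-quads : ∀ {n} → n < 4 → Transversal Equiv (IsQuadTuple n) 0
no-small-quads n<4 = transversal-empty λ t q → <⇒≱ n<4 (quad-perimeter t q)

-- evenCount j and oddCount j count the classes of perimeters 2j and 2j + 1;
-- here h = j + 1, resp. j + 2, is the longest side of perimeter 2j + 4, resp. 2j + 5.
even-quads : ∀ j → Transversal Equiv (IsQuadTuple (j * 2)) (evenCount j)
even-quads zero = no-small-quads (s≤s z≤n)
even-quads (suc zero) = no-small-quads (s≤s (s≤s (s≤s z≤n)))
even-quads (suc (suc j)) =
  count-step (j * 2) (suc j) j (3 + j) (s≤s z≤n) (inj₂ (longest j)) (unit-sum j) (long-sum j) (even-quads j)
  where
  longest : ∀ j → 4 + j * 2 ≡ 2 + 2 * suc j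
  longest = solve-∀
  unit-sum : ∀ j → 3 * suc j + 1 ≡ 4 + j * 2 + j
  unit-sum = solve-∀
  long-sum : ∀ j → 4 + j * 2 ≡ suc j + (3 + j)
  long-sum = solve-∀

odd-quads : ∀ j → Transversal Equiv (IsQuadTuple (1 + j * 2)) (oddCount j)
odd-quads zero = no-small-quads (s≤s (s≤s z≤n))
odd-quads (suc zero) = no-small-quads (s≤s (s≤s (s≤s (s≤s z≤n))))
odd-quads (suc (suc j)) =
  count-step (1 + j * 2) (2 + j) (2 + j) (3 + j) (s≤s z≤n) (inj₁ (longest j)) (unit-sum j) (long-sum j) (odd-quads j)
  where
  longest : ∀ j → 4 + (1 + j * 2) ≡ 1 + 2 * (2 + j)
  longest = solve-∀
  unit-sum : ∀ j → 3 * (2 + j) + 1 ≡ 4 + (1 + j * 2) + (2 + j)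
  unit-sum = solve-∀
  long-sum : ∀ j → 4 + (1 + j * 2) ≡ 2 + j + (3 + j)
  long-sum = solve-∀

-- Closed forms of the step counts: two consecutive triple counts sum to a
-- triangular number, so 2 (t(j) + t(j+3)) = j² + j + 2 and
-- 2 (t(j+2) + t(j+3)) = (j+1)(j+2).
triCount-consecutive : ∀ j → 2 * (triCount (1 + j) + triCount (2 + j)) ≡ j * (1 + j)
triCount-consecutive zero = refl
triCount-consecutive (suc j) = begin
  2 * (triCount (2 + j) + (1 + j + triCount (1 + j)))      ≡⟨ regroup (triCount (1 + j)) (triCount (2 + j)) j ⟩
  2 * (triCount (1 + j) + triCount (2 + j)) + 2 * (1 + j)  ≡⟨ cong (_+ 2 * (1 + j)) (triCount-consecutive j) ⟩
  j * (1 + j) + 2 * (1 + j)                                ≡⟨ factor j ⟩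
  (1 + j) * (2 + j)                                        ∎
  where
  open ≡-Reasoning
  regroup : ∀ x y j → 2 * (y + (1 + j + x)) ≡ 2 * (x + y) + 2 * (1 + j)
  regroup = solve-∀
  factor : ∀ j → j * (1 + j) + 2 * (1 + j) ≡ (1 + j) * (2 + j)
  factor = solve-∀

triCount-even-step : ∀ j → 2 * (triCount j + triCount (3 + j)) ≡ j * j + j + 2
triCount-even-step zero = refl
triCount-even-step (suc j) = begin
  2 * (triCount (1 + j) + (2 + j + triCount (2 + j)))      ≡⟨ regroup (triCount (1 + j)) (triCount (2 + j)) j ⟩
  2 * (triCount (1 + j) + triCount (2 + j)) + 2 * (2 + j)  ≡⟨ cong (_+ 2 * (2 + j)) (triCount-consecutive j) ⟩
  j * (1 + j) + 2 * (2 + j)                                ≡⟨ expand j ⟩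
  suc j * suc j + suc j + 2                                ∎
  where
  open ≡-Reasoning
  regroup : ∀ x y j → 2 * (x + (2 + j + y)) ≡ 2 * (x + y) + 2 * (2 + j)
  regroup = solve-∀
  expand : ∀ j → j * (1 + j) + 2 * (2 + j) ≡ suc j * suc j + suc j + 2
  expand = solve-∀

evenPoly oddPoly : ℤ → ℤ
evenPoly y = y ℤ.* y ℤ.* y ℤ.- (+ 3) ℤ.* y ℤ.* y ℤ.+ (+ 20) ℤ.* y
oddPoly y = y ℤ.* y ℤ.* y ℤ.- (+ 7) ℤ.* y

evenPoly-increment : ∀ x → evenPoly ((+ 2 ℤ.+ x) ℤ.* + 2) ℤ.- evenPoly (x ℤ.* + 2) ≡ + 48 ℤ.* (x ℤ.* x ℤ.+ x ℤ.+ + 2)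
evenPoly-increment = identity
  where
  identity : ∀ x → let E = λ y → y ℤ.* y ℤ.* y ℤ.- (+ 3) ℤ.* y ℤ.* y ℤ.+ (+ 20) ℤ.* y in
    E ((+ 2 ℤ.+ x) ℤ.* + 2) ℤ.- E (x ℤ.* + 2) ≡ + 48 ℤ.* (x ℤ.* x ℤ.+ x ℤ.+ + 2)
  identity = ℤ-Ring.solve-∀

oddPoly-increment : ∀ x → oddPoly (+ 1 ℤ.+ (+ 2 ℤ.+ x) ℤ.* + 2) ℤ.- oddPoly (+ 1 ℤ.+ x ℤ.* + 2) ≡ + 48 ℤ.* ((+ 1 ℤ.+ x) ℤ.* (+ 2 ℤ.+ x))
oddPoly-increment = identity
  where
  identity : ∀ x → let O = λ y → y ℤ.* y ℤ.* y ℤ.- (+ 7) ℤ.* y in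
    O (+ 1 ℤ.+ (+ 2 ℤ.+ x) ℤ.* + 2) ℤ.- O (+ 1 ℤ.+ x ℤ.* + 2) ≡ + 48 ℤ.* ((+ 1 ℤ.+ x) ℤ.* (+ 2 ℤ.+ x))
  identity = ℤ-Ring.solve-∀

-- 96 s = 48 (2 s), with 2 s computed in ℕ.
ninety-six : ∀ s → + 96 ℤ.* + s ≡ + 48 ℤ.* + (2 * s)
ninety-six s = trans (identity (+ s)) (cong (+ 48 ℤ.*_) (sym (ℤ.pos-* 2 s)))
  where
  identity : ∀ x → + 96 ℤ.* x ≡ + 48 ℤ.* (+ 2 ℤ.* x)
  identity = ℤ-Ring.solve-∀

error-step : ∀ k s p q → + 96 ℤ.* + s ≡ q ℤ.- p → + 96 ℤ.* + (k + s) ℤ.- q ≡ + 96 ℤ.* + k ℤ.- p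
error-step k s p q increment = begin
  + 96 ℤ.* (+ k ℤ.+ + s) ℤ.- q               ≡⟨ cong (ℤ._- q) (ℤ.*-distribˡ-+ (+ 96) (+ k) (+ s)) ⟩
  + 96 ℤ.* + k ℤ.+ + 96 ℤ.* + s ℤ.- q         ≡⟨ cong (λ z → + 96 ℤ.* + k ℤ.+ z ℤ.- q) increment ⟩
  + 96 ℤ.* + k ℤ.+ (q ℤ.- p) ℤ.- q            ≡⟨ cancel (+ 96 ℤ.* + k) p q ⟩
  + 96 ℤ.* + k ℤ.- p                         ∎
  where
  open ≡-Reasoning
  cancel : ∀ a p q → a ℤ.+ (q ℤ.- p) ℤ.- q ≡ a ℤ.- p
  cancel = ℤ-Ring.solve-∀

even-step : ∀ j → + 96 ℤ.* + (triCount j + triCount (3 + j)) ≡ evenPoly (+ (suc (suc j) * 2)) ℤ.- evenPoly (+ (j * 2))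
even-step j = begin
  + 96 ℤ.* + (triCount j + triCount (3 + j))      ≡⟨ ninety-six (triCount j + triCount (3 + j)) ⟩
  + 48 ℤ.* + (2 * (triCount j + triCount (3 + j))) ≡⟨ cong (λ n → + 48 ℤ.* + n) (triCount-even-step j) ⟩
  + 48 ℤ.* + (j * j + j + 2)                      ≡⟨ cong (λ z → + 48 ℤ.* (z ℤ.+ + j ℤ.+ + 2)) (ℤ.pos-* j j) ⟩
  + 48 ℤ.* (+ j ℤ.* + j ℤ.+ + j ℤ.+ + 2)          ≡⟨ sym (evenPoly-increment (+ j)) ⟩
  evenPoly ((+ 2 ℤ.+ + j) ℤ.* + 2) ℤ.- evenPoly (+ j ℤ.* + 2)
    ≡⟨ cong₂ (λ a b → evenPoly a ℤ.- evenPoly b) (sym (ℤ.pos-* (suc (suc j)) 2)) (sym (ℤ.pos-* j 2)) ⟩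
  evenPoly (+ (suc (suc j) * 2)) ℤ.- evenPoly (+ (j * 2)) ∎
  where open ≡-Reasoning

odd-step : ∀ j → + 96 ℤ.* + (triCount (2 + j) + triCount (3 + j)) ≡ oddPoly (+ (1 + suc (suc j) * 2)) ℤ.- oddPoly (+ (1 + j * 2))
odd-step j = begin
  + 96 ℤ.* + (triCount (2 + j) + triCount (3 + j))       ≡⟨ ninety-six (triCount (2 + j) + triCount (3 + j)) ⟩
  + 48 ℤ.* + (2 * (triCount (2 + j) + triCount (3 + j))) ≡⟨ cong (λ n → + 48 ℤ.* + n) (triCount-consecutive (suc j)) ⟩
  + 48 ℤ.* + ((1 + j) * (2 + j))                         ≡⟨ cong (+ 48 ℤ.*_) (ℤ.pos-* (1 + j) (2 + j)) ⟩
  + 48 ℤ.* ((+ 1 ℤ.+ + j) ℤ.* (+ 2 ℤ.+ + j))             ≡⟨ sym (oddPoly-increment (+ j)) ⟩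
  oddPoly (+ 1 ℤ.+ (+ 2 ℤ.+ + j) ℤ.* + 2) ℤ.- oddPoly (+ 1 ℤ.+ + j ℤ.* + 2)
    ≡⟨ cong₂ (λ a b → oddPoly (+ 1 ℤ.+ a) ℤ.- oddPoly (+ 1 ℤ.+ b)) (sym (ℤ.pos-* (suc (suc j)) 2)) (sym (ℤ.pos-* j 2)) ⟩
  oddPoly (+ (1 + suc (suc j) * 2)) ℤ.- oddPoly (+ (1 + j * 2)) ∎
  where open ≡-Reasoning

-- Hence the error 96 k − P(n) is periodic in j with period 2; on the first
-- two perimeters it is 0 or −36 (even) and 6 or −6 (odd), all below 48.
even-nearest : ∀ j → IsNearestTo/96 (evenCount j) (evenPoly (+ (j * 2)))
even-nearest zero = toWitness {a? = 0 <? 96} _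
even-nearest (suc zero) = toWitness {a? = 72 <? 96} _
even-nearest (suc (suc j)) =
  subst (λ e → 2 * ∣ e ∣ < 96) (sym (error-step (evenCount j) (triCount j + triCount (3 + j)) _ _ (even-step j))) (even-nearest j)

odd-nearest : ∀ j → IsNearestTo/96 (oddCount j) (oddPoly (+ (1 + j * 2)))
odd-nearest zero = toWitness {a? = 12 <? 96} _
odd-nearest (suc zero) = toWitness {a? = 12 <? 96} _
odd-nearest (suc (suc j)) =
  subst (λ e → 2 * ∣ e ∣ < 96) (sym (error-step (oddCount j) (triCount (2 + j) + triCount (3 + j)) _ _ (odd-step j))) (odd-nearest j)

data Parity : ℕ → Set where
  even : ∀ j → Parity (j * 2)
  odd  : ∀ j → Parity (1 + j * 2)

parity : ∀ n → Parity n
parity zero = even 0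
parity (suc n) with parity n
... | even j = odd j
... | odd j  = even (suc j)

theorem1p9 : ∀ (n : ℕ) → 1 ≤ n →
    ∃ λ (k : ℕ) → NumClasses n k ×
      (n % 2 ≡ 0 → IsNearestTo/96 k ((+ n) ℤ.* (+ n) ℤ.* (+ n) ℤ.- (+ 3) ℤ.* (+ n) ℤ.* (+ n) ℤ.+ (+ 20) ℤ.* (+ n))) ×
      (n % 2 ≡ 1 → IsNearestTo/96 k ((+ n) ℤ.* (+ n) ℤ.* (+ n) ℤ.- (+ 7) ℤ.* (+ n)))
theorem1p9 n _ with parity n
... | even j = evenCount j , numClasses (even-quads j) , (λ _ → even-nearest j) ,
               λ odd-remainder → contradiction (trans (sym (m*n%n≡0 j 2)) odd-remainder) λ ()
... | odd j  = oddCount j , numClasses (odd-quads j) ,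
               (λ even-remainder → contradiction (trans (sym ([m+kn]%n≡m%n 1 j 2)) even-remainder) λ ()) ,
               λ _ → odd-nearest j
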